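{- Let $R$ be a commutative ring and $(A,\beta)$ a framed $R$-algebra of rank $n$ with $\beta=(e_1,\dots,e_n)$. Then $A'=R\times A$ has the unital basis $\beta'=((1,1),(0,e_1),\dots,(0,e_n))$, and $\operatorname{disc}(R\times A,\beta')=\operatorname{disc}(A,\beta)$ in $R/R^{\times 2}$.
   Context: Rings have $1$. An $R$-algebra is a (not necessarily commutative) ring $A$ with an injective ring homomorphism $R\to A$ with image in the center of $A$. A framed $R$-algebra of rank $n$ is such an $A$ that is free of rank $n$ as an $R$-module, together with an ordered $R$-basis $\beta$; a basis is unital if its first element is $1$. For $a\in A$, $\lambda_\beta(a)=(a_{ij})\in\mathrm{M}_n(R)$ is defined by $ae_j=\sum_i a_{ij}e_i$; $t_\beta(a,b)=\operatorname{Tr}(\lambda_\beta(ab))$; $\operatorname{disc}(A,\beta)=\det\bigl(t_\beta(e_i,e_j)\bigr)_{i,j}$. $R/R^{\times2}$ denotes elements of $R$ modulo multiplication by squares of units. -}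

module Defs where

open import Level using (Level; _⊔_)
open import Data.Nat using (ℕ; zero; suc)
open import Data.Fin using (Fin; zero; suc; punchIn)
open import Data.Product using (_×_; _,_; Σ; ∃)
open import Algebra.Bundles using (CommutativeRing; Ring)
open import Algebra.Morphism.Structures using (module RingMorphisms)
import Algebra.Construct.DirectProduct as DP

private
  variable
    c ℓ a ℓa : Level

sumFin : {X : Set a} → X → (X → X → X) → {n : ℕ} → (Fin n → X) → X
sumFin z _⊕_ {zero}  f = z
sumFin z _⊕_ {suc n} f = f zero ⊕ sumFin z _⊕_ (λ i → f (suc i))

module _ (R : CommutativeRing c ℓ) where
  open CommutativeRing R using (Carrier; _≈_; _+_; _*_; -_; 0#; 1#; ring; rawRing)

  Σᴿ : {n : ℕ} → (Fin n → Carrier) → Carrier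
  Σᴿ = sumFin 0# _+_

  sgn : ℕ → Carrier
  sgn zero    = 1#
  sgn (suc k) = - sgn k

  det : (n : ℕ) → (Fin n → Fin n → Carrier) → Carrier
  det zero    M = 1#
  det (suc n) M = Σᴿ (λ j → sgn (Data.Fin.toℕ j) * (M zero j * det n (λ i k → M (suc i) (punchIn j k))))

  tr : {n : ℕ} → (Fin n → Fin n → Carrier) → Carrier
  tr M = Σᴿ (λ i → M i i)

  IsUnit : Carrier → Set (c ⊔ ℓ)
  IsUnit u = ∃ λ v → u * v ≈ 1#

  -- (A, ι, e) is a framed R-algebra of rank n:
  --  ι : R → A an injective ring homomorphism with central image,
  --  e = (e_1,…,e_n) an R-basis of A (R acting by r·a = ι(r)*a), witnessed by
  --  the coordinate map, inverse to (r_i) ↦ Σ_i ι(r_i) e_i.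
  record IsFramedAlgebra (A : Ring a ℓa) (n : ℕ)
      (ι : Carrier → Ring.Carrier A) (e : Fin n → Ring.Carrier A) : Set (c ⊔ ℓ ⊔ a ⊔ ℓa) where
    private
      module A = Ring A
    open RingMorphisms rawRing A.rawRing
    field
      isRingHom  : IsRingHomomorphism ι
      injective  : ∀ {x y} → ι x A.≈ ι y → x ≈ y
      central    : ∀ r x → ι r A.* x A.≈ x A.* ι r
      coord      : A.Carrier → Fin n → Carrier
      coord-cong : ∀ {x y} → x A.≈ y → ∀ i → coord x i ≈ coord y i
      expand     : ∀ x → x A.≈ sumFin A.0# A._+_ (λ i → ι (coord x i) A.* e i)
      coord-comb : ∀ (r : Fin n → Carrier) i →
                   coord (sumFin A.0# A._+_ (λ j → ι (r j) A.* e j)) i ≈ r i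

  module _ {A : Ring a ℓa} {n : ℕ} {ι : Carrier → Ring.Carrier A} {e : Fin n → Ring.Carrier A}
           (F : IsFramedAlgebra A n ι e) where
    private
      module A = Ring A
    open IsFramedAlgebra F

    lmat : A.Carrier → Fin n → Fin n → Carrier
    lmat x i j = coord (x A.* e j) i

    trForm : A.Carrier → A.Carrier → Carrier
    trForm x y = tr (lmat (x A.* y))

    disc : Carrier
    disc = det n (λ i j → trForm (e i) (e j))

  _×ᴿ_ : Ring a ℓa → Ring (c ⊔ a) (ℓ ⊔ ℓa)
  _×ᴿ_ A = DP.ring ring A

  prodι : (A : Ring a ℓa) → (Carrier → Ring.Carrier A) → Carrier → Ring.Carrier (_×ᴿ_ A)
  prodι A ι r = r , ι r

  prodBasis : (A : Ring a ℓa) {n : ℕ} → (Fin n → Ring.Carrier A) → Fin (suc n) → Ring.Carrier (_×ᴿ_ A)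
  prodBasis A e zero    = 1# , Ring.1# A
  prodBasis A e (suc i) = 0# , e i

module Submission where

-- In the basis (1,1), (0,e₁), …, (0,eₙ) of R × A the trace form is t′(r , x) = r + t(x), so the
-- Gram matrix has rows (1 + t(1), t(e₁), …, t(eₙ)) and (t(eᵢ), t(eᵢe₁), …, t(eᵢeₙ)).
-- Writing 1 = ∑ₖ cₖ eₖ gives t(y) = ∑ₖ cₖ t(eₖ y), so the first row is (1, 0, …, 0) plus
-- ∑ₖ cₖ·(row k+1). That row operation does not change the determinant, and expanding along the new first row
-- leaves the Gram matrix of A: the two discriminants are equal, with u = 1.

open import Defs
open import Level using (Level)
open import Data.Nat using (ℕ; zero; suc)
open import Data.Fin using (Fin; zero; suc; punchIn; toℕ)
open import Data.Product using (Σ; ∃; _×_; _,_; proj₁; proj₂)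
open import Data.Vec.Functional using (Vector; _∷_; tail)
open import Function using (_∘_)
open import Algebra.Bundles using (CommutativeRing; Ring)
open import Algebra.Morphism.Structures using (module RingMorphisms)
open import Relation.Binary.PropositionalEquality as ≡ using (_≡_; _≗_)
open import Relation.Binary.Core using (_Preserves_⟶_)
import Relation.Binary.Reasoning.Setoid as SetoidReasoning
import Algebra.Properties.Semiring.Sum as SemiringSum
import Algebra.Properties.Ring as RingProperties

module FiniteSum {a ℓ} (S : Ring a ℓ) where
  open Ring S
  open import Algebra.Properties.Ring S using (-1*x≈-x)
  private
    module Sum = SemiringSum semiring
  open Sum using (sum)
  open SetoidReasoning setoid

  ∑ : ∀ {n} → Vector Carrier n → Carrier
  ∑ = sumFin 0# _+_

  ∑≈sum : ∀ {n} (f : Vector Carrier n) → ∑ f ≈ sum f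
  ∑≈sum {zero}  f = refl
  ∑≈sum {suc n} f = +-congˡ (∑≈sum (tail f))

  ∑-cong : ∀ {n} {f g : Vector Carrier n} → (∀ i → f i ≈ g i) → ∑ f ≈ ∑ g
  ∑-cong {f = f} {g} f≈g = begin
    ∑ f    ≈⟨ ∑≈sum f ⟩
    sum f  ≈⟨ Sum.sum-cong-≋ f≈g ⟩
    sum g  ≈⟨ ∑≈sum g ⟨
    ∑ g    ∎

  ∑-zero : ∀ {n} {f : Vector Carrier n} → (∀ i → f i ≈ 0#) → ∑ f ≈ 0#
  ∑-zero {n} f≈0 = trans (∑-cong f≈0) (trans (∑≈sum {n} (λ _ → 0#)) (Sum.sum-replicate-zero n))

  ∑-distrib-+ : ∀ {n} (f g : Vector Carrier n) → ∑ (λ i → f i + g i) ≈ ∑ f + ∑ g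
  ∑-distrib-+ f g = begin
    ∑ (λ i → f i + g i)    ≈⟨ ∑≈sum (λ i → f i + g i) ⟩
    sum (λ i → f i + g i)  ≈⟨ Sum.∑-distrib-+ f g ⟩
    sum f + sum g          ≈⟨ +-cong (∑≈sum f) (∑≈sum g) ⟨
    ∑ f + ∑ g              ∎

  *-distribˡ-∑ : ∀ {n} x (f : Vector Carrier n) → x * ∑ f ≈ ∑ (λ i → x * f i)
  *-distribˡ-∑ x f = begin
    x * ∑ f                ≈⟨ *-congˡ (∑≈sum f) ⟩
    x * sum f              ≈⟨ Sum.*-distribˡ-sum x f ⟩
    sum (λ i → x * f i)    ≈⟨ ∑≈sum (λ i → x * f i) ⟨
    ∑ (λ i → x * f i)      ∎

  *-distribʳ-∑ : ∀ {n} x (f : Vector Carrier n) → ∑ f * x ≈ ∑ (λ i → f i * x)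
  *-distribʳ-∑ x f = begin
    ∑ f * x                ≈⟨ *-congʳ (∑≈sum f) ⟩
    sum f * x              ≈⟨ Sum.*-distribʳ-sum x f ⟩
    sum (λ i → f i * x)    ≈⟨ ∑≈sum (λ i → f i * x) ⟨
    ∑ (λ i → f i * x)      ∎

  -‿distrib-∑ : ∀ {n} (f : Vector Carrier n) → - ∑ f ≈ ∑ (λ i → - f i)
  -‿distrib-∑ f = begin
    - ∑ f                    ≈⟨ -1*x≈-x (∑ f) ⟨
    - 1# * ∑ f               ≈⟨ *-distribˡ-∑ (- 1#) f ⟩
    ∑ (λ i → - 1# * f i)     ≈⟨ ∑-cong (λ i → -1*x≈-x (f i)) ⟩
    ∑ (λ i → - f i)          ∎

  ∑-comm : ∀ {m n} (f : Fin m → Fin n → Carrier) →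
           ∑ (λ i → ∑ (f i)) ≈ ∑ (λ j → ∑ (λ i → f i j))
  ∑-comm f = begin
    ∑ (λ i → ∑ (f i))                ≈⟨ ∑≈sum (λ i → ∑ (f i)) ⟩
    sum (λ i → ∑ (f i))              ≈⟨ Sum.sum-cong-≋ (λ i → ∑≈sum (f i)) ⟩
    sum (λ i → sum (f i))            ≈⟨ Sum.∑-comm f ⟩
    sum (λ j → sum (λ i → f i j))    ≈⟨ Sum.sum-cong-≋ (λ j → ∑≈sum (λ i → f i j)) ⟨
    sum (λ j → ∑ (λ i → f i j))      ≈⟨ ∑≈sum (λ j → ∑ (λ i → f i j)) ⟨
    ∑ (λ j → ∑ (λ i → f i j))        ∎

module Determinant {c ℓ} (R : CommutativeRing c ℓ) where
  open CommutativeRing R hiding (zero)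
  open FiniteSum ring
  open import Algebra.Properties.Ring ring
    using (-0#≈0#; -‿involutive; +-inverseˡ-unique; -‿distribˡ-*; -‿distribʳ-*; \\-leftDividesˡ)
  open import Algebra.Properties.CommutativeSemigroup *-commutativeSemigroup using (x∙yz≈y∙xz)
  open SetoidReasoning setoid

  Row : ℕ → Set c
  Row = Vector Carrier

  Matrix : ℕ → Set c
  Matrix n = Vector (Row n) n

  sign : ∀ {n} → Fin n → Carrier
  sign j = sgn R (toℕ j)

  columns : ∀ {m n k} → (Fin k → Fin n) → Vector (Row n) m → Vector (Row k) m
  columns σ N i = N i ∘ σ

  det-cong : ∀ n {M N : Matrix n} → (∀ i k → M i k ≈ N i k) → det R n M ≈ det R n N
  det-cong zero    M≈N = refl
  det-cong (suc n) M≈N =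
    ∑-cong λ j → *-congˡ {sign j} (*-cong (M≈N zero j) (det-cong n (λ i k → M≈N (suc i) (punchIn j k))))

  det-columns-∷ : ∀ n {m} (σ : Fin (suc n) → Fin m) (v : Row m) (N : Vector (Row m) n) →
                  det R (suc n) (columns σ (v ∷ N)) ≈ det R (suc n) ((v ∘ σ) ∷ columns σ N)
  det-columns-∷ n σ v N =
    det-cong (suc n) {columns σ (v ∷ N)} {(v ∘ σ) ∷ columns σ N} λ { zero k → refl ; (suc i) k → refl }

  det-head-+ : ∀ n (u v : Row (suc n)) (N : Vector (Row (suc n)) n) →
               det R (suc n) ((λ j → u j + v j) ∷ N) ≈ det R (suc n) (u ∷ N) + det R (suc n) (v ∷ N)
  det-head-+ n u v N = begin
    ∑ (λ j → sign j * ((u j + v j) * D j))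
      ≈⟨ ∑-cong split ⟩
    ∑ (λ j → sign j * (u j * D j) + sign j * (v j * D j))
      ≈⟨ ∑-distrib-+ (λ j → sign j * (u j * D j)) (λ j → sign j * (v j * D j)) ⟩
    det R (suc n) (u ∷ N) + det R (suc n) (v ∷ N)
      ∎
    where
    D : Fin (suc n) → Carrier
    D j = det R n (columns (punchIn j) N)
    split : ∀ j → sign j * ((u j + v j) * D j) ≈ sign j * (u j * D j) + sign j * (v j * D j)
    split j = trans (*-congˡ (distribʳ (D j) (u j) (v j))) (distribˡ (sign j) (u j * D j) (v j * D j))

  det-head-∑ : ∀ n {m} (c : Vector Carrier m) (V : Vector (Row (suc n)) m) (N : Vector (Row (suc n)) n) →
               det R (suc n) ((λ j → ∑ (λ k → c k * V k j)) ∷ N) ≈ ∑ (λ k → c k * det R (suc n) (V k ∷ N))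
  det-head-∑ n c V N = begin
    ∑ (λ j → sign j * (∑ (λ k → c k * V k j) * D j))
      ≈⟨ ∑-cong (λ j → *-congˡ {sign j} (*-distribʳ-∑ (D j) (λ k → c k * V k j))) ⟩
    ∑ (λ j → sign j * ∑ (λ k → c k * V k j * D j))
      ≈⟨ ∑-cong (λ j → *-distribˡ-∑ (sign j) (λ k → c k * V k j * D j)) ⟩
    ∑ (λ j → ∑ (λ k → sign j * (c k * V k j * D j)))
      ≈⟨ ∑-cong (λ j → ∑-cong (λ k → pull (sign j) (c k) (V k j) (D j))) ⟩
    ∑ (λ j → ∑ (λ k → c k * (sign j * (V k j * D j))))
      ≈⟨ ∑-comm (λ j k → c k * (sign j * (V k j * D j))) ⟩
    ∑ (λ k → ∑ (λ j → c k * (sign j * (V k j * D j))))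
      ≈⟨ ∑-cong (λ k → *-distribˡ-∑ (c k) (λ j → sign j * (V k j * D j))) ⟨
    ∑ (λ k → c k * det R (suc n) (V k ∷ N))
      ∎
    where
    D : Fin (suc n) → Carrier
    D j = det R n (columns (punchIn j) N)
    pull : ∀ s x v d → s * (x * v * d) ≈ x * (s * (v * d))
    pull s x v d = trans (*-congˡ (*-assoc x v d)) (x∙yz≈y∙xz s x (v * d))

  det-second-+ : ∀ n (u v w : Row (suc (suc n))) (N : Vector (Row (suc (suc n))) n) →
                 det R (suc (suc n)) (u ∷ (λ j → v j + w j) ∷ N)
                   ≈ det R (suc (suc n)) (u ∷ v ∷ N) + det R (suc (suc n)) (u ∷ w ∷ N)
  det-second-+ n u v w N = begin
    ∑ (λ j → sign j * (u j * Dsum j))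
      ≈⟨ ∑-cong (λ j → *-congˡ {sign j} (*-congˡ {u j} (split j))) ⟩
    ∑ (λ j → sign j * (u j * (Dv j + Dw j)))
      ≈⟨ ∑-cong expand-term ⟩
    ∑ (λ j → sign j * (u j * Dv j) + sign j * (u j * Dw j))
      ≈⟨ ∑-distrib-+ (λ j → sign j * (u j * Dv j)) (λ j → sign j * (u j * Dw j)) ⟩
    det R (suc (suc n)) (u ∷ v ∷ N) + det R (suc (suc n)) (u ∷ w ∷ N)
      ∎
    where
    Dsum Dv Dw : Fin (suc (suc n)) → Carrier
    Dsum j = det R (suc n) (columns (punchIn j) ((λ k → v k + w k) ∷ N))
    Dv j = det R (suc n) (columns (punchIn j) (v ∷ N))
    Dw j = det R (suc n) (columns (punchIn j) (w ∷ N))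
    expand-term : ∀ j → sign j * (u j * (Dv j + Dw j)) ≈ sign j * (u j * Dv j) + sign j * (u j * Dw j)
    expand-term j = trans (*-congˡ (distribˡ (u j) (Dv j) (Dw j))) (distribˡ (sign j) (u j * Dv j) (u j * Dw j))
    split : ∀ j → Dsum j ≈ Dv j + Dw j
    split j = begin
      Dsum j
        ≈⟨ det-columns-∷ n (punchIn j) (λ k → v k + w k) N ⟩
      det R (suc n) ((λ k → v (punchIn j k) + w (punchIn j k)) ∷ columns (punchIn j) N)
        ≈⟨ det-head-+ n (v ∘ punchIn j) (w ∘ punchIn j) (columns (punchIn j) N) ⟩
      det R (suc n) ((v ∘ punchIn j) ∷ columns (punchIn j) N) + det R (suc n) ((w ∘ punchIn j) ∷ columns (punchIn j) N)
        ≈⟨ +-cong (det-columns-∷ n (punchIn j) v N) (det-columns-∷ n (punchIn j) w N) ⟨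
      Dv j + Dw j
        ∎

  -- det (u ∷ u ∷ N) expanded along its first two rows, F σ standing for det of N on the columns σ.
  expand₂ : ∀ {m} → Row (suc (suc m)) → ((Fin m → Fin (suc (suc m))) → Carrier) → Carrier
  expand₂ u F = ∑ λ j → sign j * (u j * ∑ λ l → sign l * (u (punchIn j l) * F (punchIn j ∘ punchIn l)))

  expand₂-nonzero : ∀ {m} → Row (suc (suc m)) → ((Fin m → Fin (suc (suc m))) → Carrier) → Carrier
  expand₂-nonzero u F = ∑ λ j → sign (suc j) * (u (suc j) * ∑ λ l →
                          sign (suc l) * (u (suc (punchIn j l)) * F (punchIn (suc j) ∘ punchIn (suc l))))

  expand₂-cancel : ∀ m (u : Row (suc (suc m))) F → expand₂ u F ≈ expand₂-nonzero u F
  expand₂-cancel m u F = begin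
    1# * (u zero * ∑ a) + ∑ (λ j → sign (suc j) * (u (suc j) * (1# * (u zero * G j) + rest j)))
      ≈⟨ +-cong (*-identityˡ _) (∑-cong pair-off) ⟩
    u zero * ∑ a + ∑ (λ j → - (u zero * a j) + T j)
      ≈⟨ +-congˡ (∑-distrib-+ (λ j → - (u zero * a j)) T) ⟩
    u zero * ∑ a + (∑ (λ j → - (u zero * a j)) + ∑ T)
      ≈⟨ +-congˡ (+-congʳ (-‿distrib-∑ (λ j → u zero * a j))) ⟨
    u zero * ∑ a + (- ∑ (λ j → u zero * a j) + ∑ T)
      ≈⟨ +-congˡ (+-congʳ (-‿cong (*-distribˡ-∑ (u zero) a))) ⟨
    u zero * ∑ a + (- (u zero * ∑ a) + ∑ T)
      ≈⟨ \\-leftDividesˡ (u zero * ∑ a) (∑ T) ⟩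
    ∑ T ∎
    where
    G : Fin (suc m) → Carrier
    G l = F (suc ∘ punchIn l)
    a : Fin (suc m) → Carrier
    a l = sign l * (u (suc l) * G l)
    rest : Fin (suc m) → Carrier
    rest j = ∑ λ l → sign (suc l) * (u (suc (punchIn j l)) * F (punchIn (suc j) ∘ punchIn (suc l)))
    T : Fin (suc m) → Carrier
    T j = sign (suc j) * (u (suc j) * rest j)
    -- The term (suc j, 0) cancels the term (0, j): both delete the columns 0 and suc j.
    pair-off : ∀ j → sign (suc j) * (u (suc j) * (1# * (u zero * G j) + rest j)) ≈ - (u zero * a j) + T j
    pair-off j = begin
      - sign j * (u (suc j) * (1# * (u zero * G j) + rest j))
        ≈⟨ *-congˡ (*-congˡ (+-congʳ (*-identityˡ _))) ⟩
      - sign j * (u (suc j) * (u zero * G j + rest j))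
        ≈⟨ trans (*-congˡ (distribˡ _ _ _)) (distribˡ _ _ _) ⟩
      - sign j * (u (suc j) * (u zero * G j)) + T j
        ≈⟨ +-congʳ (-‿distribˡ-* _ _) ⟨
      - (sign j * (u (suc j) * (u zero * G j))) + T j
        ≈⟨ +-congʳ (-‿cong (trans (*-congˡ (x∙yz≈y∙xz _ _ _)) (x∙yz≈y∙xz _ _ _))) ⟩
      - (u zero * a j) + T j ∎

  expand₂-nonzero-shift : ∀ m (u : Row (suc (suc (suc m)))) F → F Preserves _≗_ ⟶ _≈_ →
                          expand₂-nonzero u F ≈ expand₂ (tail u) (λ σ → F (zero ∷ suc ∘ σ))
  expand₂-nonzero-shift m u F F-resp = ∑-cong term
    where
    F′ : (Fin m → Fin (suc (suc m))) → Carrier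
    F′ σ = F (zero ∷ suc ∘ σ)
    neg-neg : ∀ s b x → - s * (b * - x) ≈ s * (b * x)
    neg-neg s b x = begin
      - s * (b * - x)    ≈⟨ *-congˡ (-‿distribʳ-* b x) ⟨
      - s * - (b * x)    ≈⟨ -‿distribʳ-* (- s) (b * x) ⟨
      - (- s * (b * x))  ≈⟨ -‿cong (-‿distribˡ-* s (b * x)) ⟨
      - - (s * (b * x))  ≈⟨ -‿involutive _ ⟩
      s * (b * x)        ∎
    inner-term : ∀ j l → sign (suc l) * (u (suc (punchIn j l)) * F (punchIn (suc j) ∘ punchIn (suc l)))
                         ≈ - (sign l * (u (suc (punchIn j l)) * F′ (punchIn j ∘ punchIn l)))
    inner-term j l = trans (*-congˡ (*-congˡ (F-resp λ { zero → ≡.refl ; (suc k) → ≡.refl })))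
                           (sym (-‿distribˡ-* _ _))
    inner : ∀ j → ∑ (λ l → sign (suc l) * (u (suc (punchIn j l)) * F (punchIn (suc j) ∘ punchIn (suc l))))
                  ≈ - ∑ (λ l → sign l * (u (suc (punchIn j l)) * F′ (punchIn j ∘ punchIn l)))
    inner j = begin
      ∑ (λ l → sign (suc l) * (u (suc (punchIn j l)) * F (punchIn (suc j) ∘ punchIn (suc l))))
        ≈⟨ ∑-cong (inner-term j) ⟩
      ∑ (λ l → - (sign l * (u (suc (punchIn j l)) * F′ (punchIn j ∘ punchIn l))))
        ≈⟨ -‿distrib-∑ (λ l → sign l * (u (suc (punchIn j l)) * F′ (punchIn j ∘ punchIn l))) ⟨
      - ∑ (λ l → sign l * (u (suc (punchIn j l)) * F′ (punchIn j ∘ punchIn l))) ∎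
    term : ∀ j → sign (suc j) * (u (suc j) *
                   ∑ λ l → sign (suc l) * (u (suc (punchIn j l)) * F (punchIn (suc j) ∘ punchIn (suc l))))
                 ≈ sign j * (u (suc j) * ∑ λ l → sign l * (u (suc (punchIn j l)) * F′ (punchIn j ∘ punchIn l)))
    term j = trans (*-congˡ (*-congˡ (inner j))) (neg-neg _ _ _)

  expand₂-vanishes : ∀ m (u : Row (suc (suc m))) F → F Preserves _≗_ ⟶ _≈_ → expand₂ u F ≈ 0#
  expand₂-vanishes zero    u F F-resp =
    trans (expand₂-cancel zero u F) (∑-zero (λ j → trans (*-congˡ (zeroʳ (u (suc j)))) (zeroʳ (sign (suc j)))))
  expand₂-vanishes (suc m) u F F-resp = begin
    expand₂ u F           ≈⟨ expand₂-cancel (suc m) u F ⟩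
    expand₂-nonzero u F   ≈⟨ expand₂-nonzero-shift m u F F-resp ⟩
    expand₂ (tail u) F′   ≈⟨ expand₂-vanishes m (tail u) F′ F′-resp ⟩
    0#                    ∎
    where
    F′ : (Fin m → Fin (suc (suc m))) → Carrier
    F′ σ = F (zero ∷ suc ∘ σ)
    F′-resp : F′ Preserves _≗_ ⟶ _≈_
    F′-resp σ≗τ = F-resp λ { zero → ≡.refl ; (suc k) → ≡.cong suc (σ≗τ k) }

  det-repeated-head : ∀ n (u : Row (suc (suc n))) (N : Vector (Row (suc (suc n))) n) →
                      det R (suc (suc n)) (u ∷ u ∷ N) ≈ 0#
  det-repeated-head n u N =
    expand₂-vanishes n u (λ σ → det R n (columns σ N))
                     (λ σ≗τ → det-cong n (λ i k → reflexive (≡.cong (N i) (σ≗τ k))))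

  det-swap-head : ∀ n (u v : Row (suc (suc n))) (N : Vector (Row (suc (suc n))) n) →
                  det R (suc (suc n)) (u ∷ v ∷ N) ≈ - det R (suc (suc n)) (v ∷ u ∷ N)
  det-swap-head n u v N = +-inverseˡ-unique (D u v) (D v u) (begin
    D u v + D v u
      ≈⟨ +-cong (+-identityˡ (D u v)) (+-identityʳ (D v u)) ⟨
    (0# + D u v) + (D v u + 0#)
      ≈⟨ +-cong (+-congʳ (det-repeated-head n u N)) (+-congˡ (det-repeated-head n v N)) ⟨
    (D u u + D u v) + (D v u + D v v)
      ≈⟨ +-cong (det-second-+ n u u v N) (det-second-+ n v u v N) ⟨
    D u (u ⊞ v) + D v (u ⊞ v)
      ≈⟨ det-head-+ (suc n) u v ((u ⊞ v) ∷ N) ⟨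
    D (u ⊞ v) (u ⊞ v)
      ≈⟨ det-repeated-head n (u ⊞ v) N ⟩
    0# ∎)
    where
    _⊞_ : Row (suc (suc n)) → Row (suc (suc n)) → Row (suc (suc n))
    (x ⊞ y) j = x j + y j
    D : Row (suc (suc n)) → Row (suc (suc n)) → Carrier
    D x y = det R (suc (suc n)) (x ∷ y ∷ N)

  det-repeated-row : ∀ n (u : Row (suc n)) (N : Vector (Row (suc n)) n) q →
                     (∀ k → N q k ≈ u k) → det R (suc n) (u ∷ N) ≈ 0#
  det-repeated-row (suc n) u N zero Nq≈u = begin
    det R (suc (suc n)) (u ∷ N)
      ≈⟨ det-cong (suc (suc n)) {u ∷ N} {u ∷ u ∷ tail N}
                  (λ { zero k → refl ; (suc zero) k → Nq≈u k ; (suc (suc i)) k → refl }) ⟩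
    det R (suc (suc n)) (u ∷ u ∷ tail N)
      ≈⟨ det-repeated-head n u (tail N) ⟩
    0# ∎
  det-repeated-row (suc n) u N (suc q) Nq≈u = begin
    det R (suc (suc n)) (u ∷ N)
      ≈⟨ det-cong (suc (suc n)) {u ∷ N} {u ∷ N zero ∷ tail N}
                  (λ { zero k → refl ; (suc zero) k → refl ; (suc (suc i)) k → refl }) ⟩
    det R (suc (suc n)) (u ∷ N zero ∷ tail N)
      ≈⟨ det-swap-head n u (N zero) (tail N) ⟩
    - det R (suc (suc n)) (N zero ∷ u ∷ tail N)
      ≈⟨ -‿cong (∑-zero minor-vanishes) ⟩
    - 0#
      ≈⟨ -0#≈0# ⟩
    0# ∎
    where
    -- Every first-row minor of N zero ∷ u ∷ tail N again has u repeated, now in row q.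
    minor-vanishes : ∀ j → sign j * (N zero j * det R (suc n) (columns (punchIn j) (u ∷ tail N))) ≈ 0#
    minor-vanishes j = begin
      sign j * (N zero j * det R (suc n) (columns (punchIn j) (u ∷ tail N)))
        ≈⟨ *-congˡ (*-congˡ (det-columns-∷ n (punchIn j) u (tail N))) ⟩
      sign j * (N zero j * det R (suc n) ((u ∘ punchIn j) ∷ columns (punchIn j) (tail N)))
        ≈⟨ *-congˡ (*-congˡ (det-repeated-row n (u ∘ punchIn j) (columns (punchIn j) (tail N)) q
                                             (λ k → Nq≈u (punchIn j k)))) ⟩
      sign j * (N zero j * 0#)
        ≈⟨ trans (*-congˡ (zeroʳ (N zero j))) (zeroʳ (sign j)) ⟩
      0# ∎

  det-reduce-head : ∀ n (M : Matrix (suc n)) (w : Row (suc n)) (c : Vector Carrier n) →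
                    (∀ j → M zero j ≈ w j + ∑ (λ k → c k * M (suc k) j)) →
                    det R (suc n) M ≈ det R (suc n) (w ∷ tail M)
  det-reduce-head n M w c M₀≈ = begin
    det R (suc n) M
      ≈⟨ det-cong (suc n) {M} {(λ j → w j + rowCombination j) ∷ tail M}
                  (λ { zero k → M₀≈ k ; (suc i) k → refl }) ⟩
    det R (suc n) ((λ j → w j + rowCombination j) ∷ tail M)
      ≈⟨ det-head-+ n w rowCombination (tail M) ⟩
    det R (suc n) (w ∷ tail M) + det R (suc n) (rowCombination ∷ tail M)
      ≈⟨ +-congˡ (det-head-∑ n c (tail M) (tail M)) ⟩
    det R (suc n) (w ∷ tail M) + ∑ (λ k → c k * det R (suc n) (M (suc k) ∷ tail M))
      ≈⟨ +-congˡ (∑-zero repeated) ⟩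
    det R (suc n) (w ∷ tail M) + 0#
      ≈⟨ +-identityʳ _ ⟩
    det R (suc n) (w ∷ tail M) ∎
    where
    rowCombination : Row (suc n)
    rowCombination j = ∑ (λ k → c k * M (suc k) j)
    repeated : ∀ k → c k * det R (suc n) (M (suc k) ∷ tail M) ≈ 0#
    repeated k = trans (*-congˡ (det-repeated-row n (M (suc k)) (tail M) k (λ _ → refl))) (zeroʳ (c k))

  det-unit-head : ∀ n (N : Vector (Row (suc n)) n) →
                  det R (suc n) ((1# ∷ λ _ → 0#) ∷ N) ≈ det R n (columns suc N)
  det-unit-head n N = begin
    1# * (1# * det R n (columns suc N)) + ∑ (λ j → sign (suc j) * (0# * D j))
      ≈⟨ +-cong (trans (*-identityˡ _) (*-identityˡ _)) (∑-zero zero-entries) ⟩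
    det R n (columns suc N) + 0#
      ≈⟨ +-identityʳ _ ⟩
    det R n (columns suc N) ∎
    where
    D : Fin n → Carrier
    D j = det R n (columns (punchIn (suc j)) N)
    zero-entries : ∀ j → sign (suc j) * (0# * D j) ≈ 0#
    zero-entries j = trans (*-congˡ (zeroˡ (D j))) (zeroʳ (sign (suc j)))

module FramedAlgebra {c ℓ a ℓa} {R : CommutativeRing c ℓ} {A : Ring a ℓa} {n : ℕ}
  {ι : CommutativeRing.Carrier R → Ring.Carrier A} {e : Fin n → Ring.Carrier A}
  (F : IsFramedAlgebra R A n ι e) where

  open CommutativeRing R hiding (zero)
  open FiniteSum ring
  private
    module A = Ring A
    module ∑A = FiniteSum A
  open IsFramedAlgebra F
  open RingMorphisms rawRing A.rawRing using (module IsRingHomomorphism)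
  open IsRingHomomorphism isRingHom using (+-homo; *-homo; 0#-homo)

  combination : Vector Carrier n → A.Carrier
  combination r = ∑A.∑ (λ j → ι (r j) A.* e j)

  coord-+ : ∀ x y i → coord (x A.+ y) i ≈ coord x i + coord y i
  coord-+ x y i = trans (coord-cong x+y≈ i) (coord-comb (λ j → coord x j + coord y j) i)
    where
    open SetoidReasoning A.setoid
    term : ∀ j → ι (coord x j) A.* e j A.+ ι (coord y j) A.* e j A.≈ ι (coord x j + coord y j) A.* e j
    term j = A.trans (A.sym (A.distribʳ (e j) _ _)) (A.*-congʳ (A.sym (+-homo _ _)))
    x+y≈ : x A.+ y A.≈ combination (λ j → coord x j + coord y j)
    x+y≈ = begin
      x A.+ y
        ≈⟨ A.+-cong (expand x) (expand y) ⟩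
      combination (coord x) A.+ combination (coord y)
        ≈⟨ ∑A.∑-distrib-+ (λ j → ι (coord x j) A.* e j) (λ j → ι (coord y j) A.* e j) ⟨
      ∑A.∑ (λ j → ι (coord x j) A.* e j A.+ ι (coord y j) A.* e j)
        ≈⟨ ∑A.∑-cong term ⟩
      combination (λ j → coord x j + coord y j) ∎

  coord-ι* : ∀ r x i → coord (ι r A.* x) i ≈ r * coord x i
  coord-ι* r x i = trans (coord-cong rx≈ i) (coord-comb (λ j → r * coord x j) i)
    where
    open SetoidReasoning A.setoid
    term : ∀ j → ι r A.* (ι (coord x j) A.* e j) A.≈ ι (r * coord x j) A.* e j
    term j = A.trans (A.sym (A.*-assoc _ _ _)) (A.*-congʳ (A.sym (*-homo _ _)))
    rx≈ : ι r A.* x A.≈ combination (λ j → r * coord x j)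
    rx≈ = begin
      ι r A.* x
        ≈⟨ A.*-congˡ (expand x) ⟩
      ι r A.* combination (coord x)
        ≈⟨ ∑A.*-distribˡ-∑ (ι r) (λ j → ι (coord x j) A.* e j) ⟩
      ∑A.∑ (λ j → ι r A.* (ι (coord x j) A.* e j))
        ≈⟨ ∑A.∑-cong term ⟩
      combination (λ j → r * coord x j) ∎

  coord-0 : ∀ i → coord A.0# i ≈ 0#
  coord-0 i = begin
    coord A.0# i             ≈⟨ coord-cong (A.trans (A.sym (A.zeroˡ A.0#)) (A.*-congʳ (A.sym 0#-homo))) i ⟩
    coord (ι 0# A.* A.0#) i  ≈⟨ coord-ι* 0# A.0# i ⟩
    0# * coord A.0# i        ≈⟨ zeroˡ _ ⟩
    0#                       ∎
    where open SetoidReasoning setoid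

  trace : A.Carrier → Carrier
  trace x = tr R (lmat R F x)

  trace-cong : ∀ {x y} → x A.≈ y → trace x ≈ trace y
  trace-cong x≈y = ∑-cong (λ i → coord-cong (A.*-congʳ x≈y) i)

  trace-+ : ∀ x y → trace (x A.+ y) ≈ trace x + trace y
  trace-+ x y = trans (∑-cong term) (∑-distrib-+ (λ i → coord (x A.* e i) i) (λ i → coord (y A.* e i) i))
    where
    term : ∀ i → coord ((x A.+ y) A.* e i) i ≈ coord (x A.* e i) i + coord (y A.* e i) i
    term i = trans (coord-cong (A.distribʳ (e i) x y) i) (coord-+ _ _ i)

  trace-ι* : ∀ r x → trace (ι r A.* x) ≈ r * trace x
  trace-ι* r x = trans (∑-cong term) (sym (*-distribˡ-∑ r (λ i → coord (x A.* e i) i)))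
    where
    term : ∀ i → coord (ι r A.* x A.* e i) i ≈ r * coord (x A.* e i) i
    term i = trans (coord-cong (A.*-assoc (ι r) x (e i)) i) (coord-ι* r _ i)

  trace-0 : trace A.0# ≈ 0#
  trace-0 = ∑-zero (λ i → trans (coord-cong (A.zeroˡ (e i)) i) (coord-0 i))

  trace-∑ : ∀ {m} (r : Vector Carrier m) (y : Vector A.Carrier m) →
            trace (∑A.∑ (λ k → ι (r k) A.* y k)) ≈ ∑ (λ k → r k * trace (y k))
  trace-∑ {zero}  r y = trace-0
  trace-∑ {suc m} r y = trans (trace-+ _ _) (+-cong (trace-ι* _ _) (trace-∑ (tail r) (tail y)))

  trace-via-1 : ∀ y → trace y ≈ ∑ (λ k → coord A.1# k * trace (e k A.* y))
  trace-via-1 y = trans (trace-cong y≈) (trace-∑ (coord A.1#) (λ k → e k A.* y))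
    where
    open SetoidReasoning A.setoid
    y≈ : y A.≈ ∑A.∑ (λ k → ι (coord A.1# k) A.* (e k A.* y))
    y≈ = begin
      y
        ≈⟨ A.*-identityˡ y ⟨
      A.1# A.* y
        ≈⟨ A.*-congʳ (expand A.1#) ⟩
      combination (coord A.1#) A.* y
        ≈⟨ ∑A.*-distribʳ-∑ y (λ k → ι (coord A.1# k) A.* e k) ⟩
      ∑A.∑ (λ k → ι (coord A.1# k) A.* e k A.* y)
        ≈⟨ ∑A.∑-cong (λ k → A.*-assoc (ι (coord A.1# k)) (e k) y) ⟩
      ∑A.∑ (λ k → ι (coord A.1# k) A.* (e k A.* y)) ∎

module ProductFramedAlgebra {c ℓ a ℓa} {R : CommutativeRing c ℓ} {A : Ring a ℓa} {n : ℕ}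
  {ι : CommutativeRing.Carrier R → Ring.Carrier A} {e : Fin n → Ring.Carrier A}
  (F : IsFramedAlgebra R A n ι e) where

  open CommutativeRing R hiding (zero)
  open FiniteSum ring
  open Determinant R
  open FramedAlgebra F
  private
    module A = Ring A
    module ∑A = FiniteSum A
    module R×A = Ring (_×ᴿ_ R A)
    module ∑R×A = FiniteSum (_×ᴿ_ R A)
  open IsFramedAlgebra F
  open RingMorphisms rawRing A.rawRing using (module IsRingHomomorphism)
  open IsRingHomomorphism isRingHom using (⟦⟧-cong; +-homo; *-homo; 0#-homo; 1#-homo; -‿homo)
  open RingProperties A using ()
    renaming ( -0#≈0# to -0#≈0#ᴬ
             ; \\-leftDividesˡ to \\-leftDividesˡᴬ
             ; \\-leftDividesʳ to \\-leftDividesʳᴬ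
             )

  ι′ : Carrier → R×A.Carrier
  ι′ = prodι R A ι

  β′ : Fin (suc n) → R×A.Carrier
  β′ = prodBasis R A e

  proj₁-∑ : ∀ {m} (g : Vector R×A.Carrier m) → proj₁ (∑R×A.∑ g) ≡ ∑ (proj₁ ∘ g)
  proj₁-∑ {zero}  g = ≡.refl
  proj₁-∑ {suc m} g = ≡.cong (proj₁ (g zero) +_) (proj₁-∑ (tail g))

  proj₂-∑ : ∀ {m} (g : Vector R×A.Carrier m) → proj₂ (∑R×A.∑ g) ≡ ∑A.∑ (proj₂ ∘ g)
  proj₂-∑ {zero}  g = ≡.refl
  proj₂-∑ {suc m} g = ≡.cong (proj₂ (g zero) A.+_) (proj₂-∑ (tail g))

  combination′ : Vector Carrier (suc n) → R×A.Carrier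
  combination′ r = ∑R×A.∑ (λ j → ι′ (r j) R×A.* β′ j)

  proj₁-combination′ : ∀ r → proj₁ (combination′ r) ≈ r zero
  proj₁-combination′ r = begin
    proj₁ (combination′ r)
      ≡⟨ proj₁-∑ (λ j → ι′ (r j) R×A.* β′ j) ⟩
    r zero * 1# + ∑ (λ j → r (suc j) * 0#)
      ≈⟨ +-cong (*-identityʳ (r zero)) (∑-zero (λ j → zeroʳ (r (suc j)))) ⟩
    r zero + 0#
      ≈⟨ +-identityʳ (r zero) ⟩
    r zero ∎
    where open SetoidReasoning setoid

  proj₂-combination′ : ∀ r → proj₂ (combination′ r) A.≈ ι (r zero) A.+ combination (tail r)
  proj₂-combination′ r = A.trans (A.reflexive (proj₂-∑ (λ j → ι′ (r j) R×A.* β′ j)))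
                                 (A.+-congʳ (A.*-identityʳ (ι (r zero))))

  -- (r , x) = r·(1 , 1) + (0 , x − ι r).
  coord′ : R×A.Carrier → Vector Carrier (suc n)
  coord′ (r , x) = r ∷ coord (A.- ι r A.+ x)

  coord′-cong : ∀ {x y} → x R×A.≈ y → ∀ i → coord′ x i ≈ coord′ y i
  coord′-cong (r≈s , x≈y) zero    = r≈s
  coord′-cong (r≈s , x≈y) (suc i) = coord-cong (A.+-cong (A.-‿cong (⟦⟧-cong r≈s)) x≈y) i

  expand′ : ∀ x → x R×A.≈ combination′ (coord′ x)
  expand′ (r , x) = sym (proj₁-combination′ (coord′ (r , x))) , A.sym (begin
    proj₂ (combination′ (coord′ (r , x)))            ≈⟨ proj₂-combination′ (coord′ (r , x)) ⟩
    ι r A.+ combination (coord (A.- ι r A.+ x))      ≈⟨ A.+-congˡ (expand (A.- ι r A.+ x)) ⟨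
    ι r A.+ (A.- ι r A.+ x)                          ≈⟨ \\-leftDividesˡᴬ (ι r) x ⟩
    x                                                ∎)
    where open SetoidReasoning A.setoid

  coord′-combination′ : ∀ r i → coord′ (combination′ r) i ≈ r i
  coord′-combination′ r zero    = proj₁-combination′ r
  coord′-combination′ r (suc i) = trans (coord-cong A-part i) (coord-comb (tail r) i)
    where
    open SetoidReasoning A.setoid
    A-part : A.- ι (proj₁ (combination′ r)) A.+ proj₂ (combination′ r) A.≈ combination (tail r)
    A-part = begin
      A.- ι (proj₁ (combination′ r)) A.+ proj₂ (combination′ r)
        ≈⟨ A.+-cong (A.-‿cong (⟦⟧-cong (proj₁-combination′ r))) (proj₂-combination′ r) ⟩
      A.- ι (r zero) A.+ (ι (r zero) A.+ combination (tail r))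
        ≈⟨ \\-leftDividesʳᴬ (ι (r zero)) (combination (tail r)) ⟩
      combination (tail r) ∎

  ι′-isRingHomomorphism : RingMorphisms.IsRingHomomorphism rawRing R×A.rawRing ι′
  ι′-isRingHomomorphism = record
    { isSemiringHomomorphism = record
      { isNearSemiringHomomorphism = record
        { +-isMonoidHomomorphism = record
          { isMagmaHomomorphism = record
            { isRelHomomorphism = record { cong = λ r≈s → r≈s , ⟦⟧-cong r≈s }
            ; homo = λ r s → refl , +-homo r s }
          ; ε-homo = refl , 0#-homo }
        ; *-homo = λ r s → refl , *-homo r s }
      ; 1#-homo = refl , 1#-homo }
    ; -‿homo = λ r → refl , -‿homo r }

  ×-isFramedAlgebra : IsFramedAlgebra R (_×ᴿ_ R A) (suc n) ι′ β′
  ×-isFramedAlgebra = record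
    { isRingHom  = ι′-isRingHomomorphism
    ; injective  = proj₁
    ; central    = λ r x → *-comm r (proj₁ x) , central r (proj₂ x)
    ; coord      = coord′
    ; coord-cong = coord′-cong
    ; expand     = expand′
    ; coord-comb = coord′-combination′
    }

  trace′ : R×A.Carrier → Carrier
  trace′ x = tr R (lmat R ×-isFramedAlgebra x)

  trace′-pair : ∀ r x → trace′ (r , x) ≈ r + trace x
  trace′-pair r x = +-cong (*-identityʳ r) (∑-cong term)
    where
    -ιr0≈0 : A.- ι (r * 0#) A.≈ A.0#
    -ιr0≈0 = A.trans (A.-‿cong (A.trans (⟦⟧-cong (zeroʳ r)) 0#-homo)) -0#≈0#ᴬ
    term : ∀ i → coord (A.- ι (r * 0#) A.+ x A.* e i) i ≈ coord (x A.* e i) i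
    term i = coord-cong (A.trans (A.+-congʳ -ιr0≈0) (A.+-identityˡ (x A.* e i))) i

  gram′ : Matrix (suc n)
  gram′ i j = trForm R ×-isFramedAlgebra (β′ i) (β′ j)

  gram′-head : ∀ j → gram′ zero j ≈ proj₁ (β′ j) + trace (proj₂ (β′ j))
  gram′-head j = trans (trace′-pair _ _) (+-cong (*-identityˡ _) (trace-cong (A.*-identityˡ _)))

  gram′-tail : ∀ k j → gram′ (suc k) j ≈ trace (e k A.* proj₂ (β′ j))
  gram′-tail k j = trans (trace′-pair _ _) (trans (+-congʳ (zeroˡ _)) (+-identityˡ _))

  gram′-head-row : ∀ j → gram′ zero j ≈ proj₁ (β′ j) + ∑ (λ k → coord A.1# k * gram′ (suc k) j)
  gram′-head-row j = trans (gram′-head j) (+-congˡ (trans (trace-via-1 (proj₂ (β′ j))) (∑-cong term)))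
    where
    term : ∀ k → coord A.1# k * trace (e k A.* proj₂ (β′ j)) ≈ coord A.1# k * gram′ (suc k) j
    term k = *-congˡ (sym (gram′-tail k j))

  disc-× : disc R ×-isFramedAlgebra ≈ disc R F
  disc-× = begin
    det R (suc n) gram′
      ≈⟨ det-reduce-head n gram′ (proj₁ ∘ β′) (coord A.1#) gram′-head-row ⟩
    det R (suc n) ((proj₁ ∘ β′) ∷ tail gram′)
      ≈⟨ det-cong (suc n) {(proj₁ ∘ β′) ∷ tail gram′} {(1# ∷ λ _ → 0#) ∷ tail gram′}
                  (λ { zero zero → refl ; zero (suc k) → refl ; (suc i) k → refl }) ⟩
    det R (suc n) ((1# ∷ λ _ → 0#) ∷ tail gram′)
      ≈⟨ det-unit-head n (tail gram′) ⟩
    det R n (columns suc (tail gram′))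
      ≈⟨ det-cong n (λ i k → gram′-tail i (suc k)) ⟩
    disc R F ∎
    where open SetoidReasoning setoid

lemma3p12 : ∀ {c ℓ a ℓa : Level} (R : CommutativeRing c ℓ) (A : Ring a ℓa) (n : ℕ)
              (ι : CommutativeRing.Carrier R → Ring.Carrier A) (e : Fin n → Ring.Carrier A)
              (F : IsFramedAlgebra R A n ι e) →
              Σ (IsFramedAlgebra R (_×ᴿ_ R A) (suc n) (prodι R A ι) (prodBasis R A e)) λ F′ →
                ∃ λ u → IsUnit R u ×
                  CommutativeRing._≈_ R (disc R F′)
                    (CommutativeRing._*_ R (CommutativeRing._*_ R u u) (disc R F))
lemma3p12 R A n ι e F = ×-isFramedAlgebra , 1# , (1# , *-identityˡ 1#) , (begin
    disc R ×-isFramedAlgebra  ≈⟨ disc-× ⟩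
    disc R F                  ≈⟨ *-identityˡ (disc R F) ⟨
    1# * disc R F             ≈⟨ *-congʳ (*-identityˡ 1#) ⟨
    1# * 1# * disc R F        ∎)
  where
  open CommutativeRing R
  open ProductFramedAlgebra F
  open SetoidReasoning setoid
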